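{- Let $\mathcal P=(\mathcal C,\mathcal A)$ be a palette with $n=|\mathcal C|\ge 1$ colors. Then \[d(\mathcal P)\le \frac14+\frac{1}{2n}\sum_{a\in\mathcal C}\ \sum_{\substack{i,j\in\{1,2,3\}\\ i\ne j}}\left(e_{i,j}(a)-\frac12\right)^2.\]
   Context: A palette $\mathcal P=(\mathcal C,\mathcal A)$ consists of a finite set $\mathcal C$ of colors and a set $\mathcal A\subseteq\mathcal C^3$ of ordered triples (admissible triples); its density is $d(\mathcal P)=|\mathcal A|/|\mathcal C|^3$. For colors $a,b\in\mathcal C$ and distinct $i,j\in\{1,2,3\}$, the pair $(a,b)$ is called $(i,j)$-good if there exists $(c_1,c_2,c_3)\in\mathcal A$ with $c_i=a$ and $c_j=b$. Let $d_{i,j}(a)$ be the number of colors $b\in\mathcal C$ such that $(a,b)$ is $(i,j)$-good, and $e_{i,j}(a)=d_{i,j}(a)/|\mathcal C|$. The inner sum runs over the six ordered pairs $(i,j)$ of distinct indices. -}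

module Defs where

open import Data.Nat using (ℕ; NonZero; _^_)
import Data.Nat.Properties as ℕP
open import Data.Bool using (Bool; true; false; _∧_; T)
open import Data.Fin using (Fin; zero; suc; _≟_)
open import Data.List using (List; []; _∷_; length; filter; map; concatMap; allFin)
open import Data.Bool.ListAction using (any)
open import Data.Product using (_×_; _,_; proj₁; proj₂)
open import Relation.Nullary.Decidable using (⌊_⌋; ¬?)
open import Data.Integer using (+_)
open import Data.Rational using (ℚ; _/_; _+_; _*_; _-_; ½; _≤_)
import Data.Rational as ℚ

record Palette (n : ℕ) : Set where
  field
    admissible : Fin n → Fin n → Fin n → Bool

Triple : ℕ → Set
Triple n = Fin n × Fin n × Fin n

allTriples : (n : ℕ) → List (Triple n)
allTriples n = concatMap (λ a → concatMap (λ b → map (λ c → a , b , c) (allFin n)) (allFin n)) (allFin n)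

-- the i-th coordinate of a triple, i ∈ {1,2,3} represented by Fin 3
coord : ∀ {n} → Fin 3 → Triple n → Fin n
coord zero (a , b , c) = a
coord (suc zero) (a , b , c) = b
coord (suc (suc zero)) (a , b , c) = c

isAdm : ∀ {n} → Palette n → Triple n → Bool
isAdm P (a , b , c) = Palette.admissible P a b c

numAdm : ∀ {n} → Palette n → ℕ
numAdm {n} P = length (filter (λ t → T? (isAdm P t)) (allTriples n))
  where
  open import Data.Bool.Properties using () renaming (T? to T?)

good : ∀ {n} → Palette n → Fin 3 → Fin 3 → Fin n → Fin n → Bool
good {n} P i j a b =
  any (λ t → isAdm P t ∧ ⌊ coord i t ≟ a ⌋ ∧ ⌊ coord j t ≟ b ⌋) (allTriples n)

dij : ∀ {n} → Palette n → Fin 3 → Fin 3 → Fin n → ℕ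
dij {n} P i j a = length (filter (λ b → T? (good P i j a b)) (allFin n))
  where
  open import Data.Bool.Properties using () renaming (T? to T?)

eij : ∀ {n} .{{_ : NonZero n}} → Palette n → Fin 3 → Fin 3 → Fin n → ℚ
eij {n} P i j a = + dij P i j a / n

density : ∀ {n} .{{_ : NonZero n}} → Palette n → ℚ
density {n} P = _/_ (+ numAdm P) (n ^ 3) {{ℕP.m^n≢0 n 3}}

distinctPairs : List (Fin 3 × Fin 3)
distinctPairs =
  filter (λ p → ¬? (proj₁ p ≟ proj₂ p))
    (concatMap (λ i → map (λ j → i , j) (allFin 3)) (allFin 3))

sumℚ : ∀ {A : Set} → (A → ℚ) → List A → ℚ
sumℚ f [] = ℚ.0ℚ
sumℚ f (x ∷ xs) = f x + sumℚ f xs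

bound : ∀ {n} .{{_ : NonZero n}} → Palette n → ℚ
bound {n} P =
  (+ 1 / 4) + (+ 1 / (2 ℕ.* n)) {{ℕP.m*n≢0 2 n}} *
    sumℚ (λ a → sumℚ (λ p → sq (eij P (proj₁ p) (proj₂ p) a - ½)) distinctPairs) (allFin n)
  where
  import Data.Nat as ℕ
  sq : ℚ → ℚ
  sq x = x * x

-- For a triple (a, b, c) let u, v, w indicate that (a, b), (a, c), (b, c) are (1,2)-, (1,3)-
-- and (2,3)-good.  An admissible triple has u = v = w = 1, and for arbitrary bits
-- u + v + w ≤ 1 + uv + uw + vw, so in all cases [abc ∈ A] + u + v + w ≤ 1 + uv + uw + vw.
-- Summing over the n³ triples, each linear term becomes n ∑ₐ d_{i,j}(a), and each product of
-- two pairs sharing a coordinate becomes ∑ₐ d_{i,j}(a) d_{i,k}(a).  With ∑ₐ d_{i,j}(a) =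
-- ∑ₐ d_{j,i}(a) and 2xy ≤ x² + y² this yields
--   2|A| + n ∑ₐ ∑_{i≠j} d_{i,j}(a) ≤ 2n³ + ∑ₐ ∑_{i≠j} d_{i,j}(a)²,
-- which is the claimed bound multiplied by 2n³.
module Submission where

open import Defs
open import Data.Nat using (ℕ; NonZero)

module Counting where

  open import Data.Nat using (zero; suc; _+_; _*_; _^_; _≤_; z≤n)
  import Data.Nat.Properties as ℕₚ
  open import Data.Nat.ListAction using () renaming (sum to sumₗ)
  open import Data.Nat.Solver using (module +-*-Solver)
  open import Algebra.Properties.Semiring.Sum ℕₚ.+-*-semiring
    using (sum-syntax; sum-cong-≗; ∑-distrib-+; ∑-comm; *-distribˡ-sum; *-distribʳ-sum)
  open import Data.Bool using (Bool; true; false; T; _∧_)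
  open import Data.Bool.Properties using (T?; T-∧; ∧-comm)
  open import Data.Bool.ListAction using (or)
  open import Data.Empty using (⊥-elim)
  open import Data.Unit using (tt)
  open import Data.Fin using (Fin; zero; suc; _≟_)
  open import Data.Fin.Patterns using (0F; 1F; 2F)
  open import Data.List using (List; []; _∷_; _++_; length; filter; map; concatMap; tabulate; allFin)
  open import Data.List.Properties using (filter-++; length-++; map-tabulate; map-cong)
  open import Data.List.Membership.Propositional using (_∈_; lose)
  open import Data.List.Membership.Propositional.Properties using (∈-allFin; ∈-map⁺; ∈-concatMap⁺)
  open import Data.List.Relation.Unary.Any.Properties using (any⁺)
  open import Data.Product using (_,_; uncurry)
  open import Data.Sum using (inj₁; inj₂)
  open import Function using (_∘_; id; Equivalence)
  open import Relation.Nullary.Decidable using (⌊_⌋; fromWitness)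
  open import Relation.Binary.PropositionalEquality

  ∑-const : ∀ n x → ∑[ i < n ] x ≡ n * x
  ∑-const zero    x = refl
  ∑-const (suc n) x = cong (x +_) (∑-const n x)

  ∑-mono-≤ : ∀ {n} {f g : Fin n → ℕ} → (∀ i → f i ≤ g i) → ∑[ i < n ] f i ≤ ∑[ i < n ] g i
  ∑-mono-≤ {zero}  f≤g = z≤n
  ∑-mono-≤ {suc n} f≤g = ℕₚ.+-mono-≤ (f≤g zero) (∑-mono-≤ (f≤g ∘ suc))

  ∑∑-separable : ∀ {m n} (f : Fin m → ℕ) (g : Fin n → ℕ) →
                 ∑[ i < m ] ∑[ j < n ] (f i * g j) ≡ (∑[ i < m ] f i) * (∑[ j < n ] g j)
  ∑∑-separable {m} f g = trans (sum-cong-≗ {m} λ i → sym (*-distribˡ-sum (f i) g)) (sym (*-distribʳ-sum _ f))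

  ∑-sumₗ-comm : ∀ {A : Set} {n} (f : A → Fin n → ℕ) (xs : List A) →
                ∑[ i < n ] sumₗ (map (λ x → f x i) xs) ≡ sumₗ (map (λ x → ∑[ i < n ] f x i) xs)
  ∑-sumₗ-comm {n = n} f []       = trans (∑-const n 0) (ℕₚ.*-zeroʳ n)
  ∑-sumₗ-comm         f (x ∷ xs) = trans (∑-distrib-+ (f x) _) (cong (_ +_) (∑-sumₗ-comm f xs))

  sumₗ-map-tabulate : ∀ {A : Set} {n} (f : A → ℕ) (g : Fin n → A) → sumₗ (map f (tabulate g)) ≡ ∑[ i < n ] f (g i)
  sumₗ-map-tabulate {n = zero}  f g = refl
  sumₗ-map-tabulate {n = suc n} f g = cong (f (g zero) +_) (sumₗ-map-tabulate f (g ∘ suc))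

  module _ {n : ℕ} where

    ∑³ : (Fin n → Fin n → Fin n → ℕ) → ℕ
    ∑³ f = ∑[ a < n ] ∑[ b < n ] ∑[ c < n ] f a b c

    infixl 7 _⊛_
    infixl 6 _⊕_

    _⊕_ _⊛_ : (f g : Fin n → Fin n → Fin n → ℕ) → Fin n → Fin n → Fin n → ℕ
    (f ⊕ g) a b c = f a b c + g a b c
    (f ⊛ g) a b c = f a b c * g a b c

    ∑³-distrib-+ : (f g : Fin n → Fin n → Fin n → ℕ) → ∑³ (f ⊕ g) ≡ ∑³ f + ∑³ g
    ∑³-distrib-+ f g =
      trans (sum-cong-≗ {n} λ a → trans (sum-cong-≗ {n} λ b → ∑-distrib-+ (f a b) (g a b))
                                        (∑-distrib-+ (∑c f a) (∑c g a)))
            (∑-distrib-+ (λ a → ∑[ b < n ] ∑c f a b) (λ a → ∑[ b < n ] ∑c g a b))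
      where
      ∑c : (Fin n → Fin n → Fin n → ℕ) → Fin n → Fin n → ℕ
      ∑c h a b = ∑[ c < n ] h a b c

    ∑³-distrib-+₄ : (f g h k : Fin n → Fin n → Fin n → ℕ) → ∑³ (f ⊕ (g ⊕ h ⊕ k)) ≡ ∑³ f + (∑³ g + ∑³ h + ∑³ k)
    ∑³-distrib-+₄ f g h k = trans (∑³-distrib-+ f (g ⊕ h ⊕ k))
      (cong (∑³ f +_) (trans (∑³-distrib-+ (g ⊕ h) k) (cong (_+ ∑³ k) (∑³-distrib-+ g h))))

    ∑³-mono-≤ : {f g : Fin n → Fin n → Fin n → ℕ} → (∀ a b c → f a b c ≤ g a b c) → ∑³ f ≤ ∑³ g
    ∑³-mono-≤ f≤g = ∑-mono-≤ λ a → ∑-mono-≤ λ b → ∑-mono-≤ λ c → f≤g a b c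

    ∑³-one : ∑³ (λ _ _ _ → 1) ≡ n ^ 3
    ∑³-one = trans (sum-cong-≗ {n} λ a → trans (sum-cong-≗ {n} λ b → ∑-const n 1) (∑-const n (n * 1)))
                   (∑-const n (n * (n * 1)))

    ∑³-const-c : (f : Fin n → Fin n → ℕ) → ∑³ (λ a b _ → f a b) ≡ n * ∑[ a < n ] ∑[ b < n ] f a b
    ∑³-const-c f = trans (sum-cong-≗ {n} λ a → trans (sum-cong-≗ {n} λ b → ∑-const n (f a b))
                                                     (sym (*-distribˡ-sum n (f a))))
                         (sym (*-distribˡ-sum n λ a → ∑[ b < n ] f a b))

    ∑³-const-b : (f : Fin n → Fin n → ℕ) → ∑³ (λ a _ c → f a c) ≡ n * ∑[ a < n ] ∑[ c < n ] f a c
    ∑³-const-b f = trans (sum-cong-≗ {n} λ a → ∑-const n _) (sym (*-distribˡ-sum n λ a → ∑[ c < n ] f a c))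

    ∑³-const-a : (f : Fin n → Fin n → ℕ) → ∑³ (λ _ b c → f b c) ≡ n * ∑[ b < n ] ∑[ c < n ] f b c
    ∑³-const-a f = ∑-const n _

    ∑³-ab*ac : (f g : Fin n → Fin n → ℕ) →
               ∑³ (λ a b c → f a b * g a c) ≡ ∑[ a < n ] ((∑[ b < n ] f a b) * (∑[ c < n ] g a c))
    ∑³-ab*ac f g = sum-cong-≗ {n} λ a → ∑∑-separable (f a) (g a)

    ∑³-ab*bc : (f g : Fin n → Fin n → ℕ) →
               ∑³ (λ a b c → f a b * g b c) ≡ ∑[ b < n ] ((∑[ a < n ] f a b) * (∑[ c < n ] g b c))
    ∑³-ab*bc f g = trans (∑-comm λ a b → ∑[ c < n ] (f a b * g b c))
                         (sum-cong-≗ {n} λ b → ∑∑-separable (λ a → f a b) (g b))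

    ∑³-ac*bc : (f g : Fin n → Fin n → ℕ) →
               ∑³ (λ a b c → f a c * g b c) ≡ ∑[ c < n ] ((∑[ a < n ] f a c) * (∑[ b < n ] g b c))
    ∑³-ac*bc f g = trans (sum-cong-≗ {n} λ a → ∑-comm λ b c → f a c * g b c)
                   (trans (∑-comm λ a c → ∑[ b < n ] (f a c * g b c))
                          (sum-cong-≗ {n} λ c → ∑∑-separable (λ a → f a c) (λ b → g b c)))

  χ : Bool → ℕ
  χ true  = 1
  χ false = 0

  χ-bonferroni : ∀ x y z → χ x + χ y + χ z ≤ 1 + (χ x * χ y + χ x * χ z + χ y * χ z)
  χ-bonferroni true  true  true  = ℕₚ.n≤1+n 3
  χ-bonferroni true  true  false = ℕₚ.≤-refl
  χ-bonferroni true  false true  = ℕₚ.≤-refl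
  χ-bonferroni true  false false = ℕₚ.≤-refl
  χ-bonferroni false true  true  = ℕₚ.≤-refl
  χ-bonferroni false true  false = ℕₚ.≤-refl
  χ-bonferroni false false true  = ℕₚ.≤-refl
  χ-bonferroni false false false = z≤n

  χ-bonferroni-forced : ∀ e x y z → (T e → T (x ∧ y ∧ z)) →
                        χ e + (χ x + χ y + χ z) ≤ 1 + (χ x * χ y + χ x * χ z + χ y * χ z)
  χ-bonferroni-forced false x     y     z     _     = χ-bonferroni x y z
  χ-bonferroni-forced true  true  true  true  _     = ℕₚ.≤-refl
  χ-bonferroni-forced true  false _     _     e⇒xyz = ⊥-elim (e⇒xyz tt)
  χ-bonferroni-forced true  true  false _     e⇒xyz = ⊥-elim (e⇒xyz tt)
  χ-bonferroni-forced true  true  true  false e⇒xyz = ⊥-elim (e⇒xyz tt)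

  count-tabulate : ∀ {A : Set} {n} (p : A → Bool) (f : Fin n → A) →
                   length (filter (T? ∘ p) (tabulate f)) ≡ ∑[ i < n ] χ (p (f i))
  count-tabulate {n = zero}  p f = refl
  count-tabulate {n = suc n} p f with p (f zero)
  ... | true  = cong suc (count-tabulate p (f ∘ suc))
  ... | false = count-tabulate p (f ∘ suc)

  count-concatMap-tabulate : ∀ {A B : Set} {n} (p : B → Bool) (g : A → List B) (f : Fin n → A) →
    length (filter (T? ∘ p) (concatMap g (tabulate f))) ≡ ∑[ i < n ] length (filter (T? ∘ p) (g (f i)))
  count-concatMap-tabulate {n = zero}  p g f = refl
  count-concatMap-tabulate {n = suc n} p g f = begin
    length (filter (T? ∘ p) (g (f zero) ++ concatMap g (tabulate (f ∘ suc))))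
      ≡⟨ cong length (filter-++ (T? ∘ p) (g (f zero)) _) ⟩
    length (filter (T? ∘ p) (g (f zero)) ++ filter (T? ∘ p) (concatMap g (tabulate (f ∘ suc))))
      ≡⟨ length-++ (filter (T? ∘ p) (g (f zero))) ⟩
    length (filter (T? ∘ p) (g (f zero))) + length (filter (T? ∘ p) (concatMap g (tabulate (f ∘ suc))))
      ≡⟨ cong (_ +_) (count-concatMap-tabulate p g (f ∘ suc)) ⟩
    ∑[ i < suc n ] length (filter (T? ∘ p) (g (f i))) ∎
    where open ≡-Reasoning

  ∈-allTriples : ∀ {n} (t : Triple n) → t ∈ allTriples n
  ∈-allTriples (a , b , c) =
    ∈-concatMap⁺ _ (lose (∈-allFin a) (∈-concatMap⁺ _ (lose (∈-allFin b) (∈-map⁺ _ (∈-allFin c)))))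

  2*m*[m+k]≤m*m+[m+k]*[m+k] : ∀ m k → 2 * (m * (m + k)) ≤ m * m + (m + k) * (m + k)
  2*m*[m+k]≤m*m+[m+k]*[m+k] m k = subst (2 * (m * (m + k)) ≤_)
    (solve 2 (λ m k → con 2 :* (m :* (m :+ k)) :+ k :* k := m :* m :+ (m :+ k) :* (m :+ k)) refl m k)
    (ℕₚ.m≤m+n _ (k * k))
    where open +-*-Solver

  2*m*n≤m*m+n*n : ∀ m n → 2 * (m * n) ≤ m * m + n * n
  2*m*n≤m*m+n*n m n with ℕₚ.≤-total m n
  ... | inj₁ m≤n with k , refl ← ℕₚ.m≤n⇒∃[o]m+o≡n m≤n = 2*m*[m+k]≤m*m+[m+k]*[m+k] m k
  ... | inj₂ n≤m with k , refl ← ℕₚ.m≤n⇒∃[o]m+o≡n n≤m =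
    subst₂ _≤_ (cong (2 *_) (ℕₚ.*-comm n m)) (ℕₚ.+-comm (n * n) (m * m)) (2*m*[m+k]≤m*m+[m+k]*[m+k] n k)

  -- distinctPairs is a closed list, so pairSum f computes to
  -- f 0F 1F + (f 0F 2F + (f 1F 0F + (f 1F 2F + (f 2F 0F + (f 2F 1F + 0))))),
  -- which is what the solver calls below are applied to.
  pairSum : (Fin 3 → Fin 3 → ℕ) → ℕ
  pairSum f = sumₗ (map (uncurry f) distinctPairs)

  pairSum-sym : (f : Fin 3 → Fin 3 → ℕ) → (∀ i j → f i j ≡ f j i) → pairSum f ≡ 2 * (f 0F 1F + f 0F 2F + f 1F 2F)
  pairSum-sym f f-sym = begin
    pairSum f
      ≡⟨ solve 6 (λ a b c d e g → a :+ (b :+ (c :+ (d :+ (e :+ (g :+ con 0))))) := (a :+ c) :+ (b :+ e) :+ (d :+ g))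
               refl (f 0F 1F) (f 0F 2F) (f 1F 0F) (f 1F 2F) (f 2F 0F) (f 2F 1F) ⟩
    (f 0F 1F + f 1F 0F) + (f 0F 2F + f 2F 0F) + (f 1F 2F + f 2F 1F)
      ≡⟨ cong₂ _+_ (cong₂ _+_ (cong (f 0F 1F +_) (f-sym 1F 0F)) (cong (f 0F 2F +_) (f-sym 2F 0F)))
                   (cong (f 1F 2F +_) (f-sym 2F 1F)) ⟩
    (f 0F 1F + f 0F 1F) + (f 0F 2F + f 0F 2F) + (f 1F 2F + f 1F 2F)
      ≡⟨ solve 3 (λ x y z → (x :+ x) :+ (y :+ y) :+ (z :+ z) := con 2 :* (x :+ y :+ z)) refl (f 0F 1F) (f 0F 2F) (f 1F 2F) ⟩
    2 * (f 0F 1F + f 0F 2F + f 1F 2F) ∎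
    where
    open ≡-Reasoning
    open +-*-Solver

  pairSum-squares : (f : Fin 3 → Fin 3 → ℕ) →
    2 * (f 0F 1F * f 0F 2F + f 1F 0F * f 1F 2F + f 2F 0F * f 2F 1F) ≤ pairSum (λ i j → f i j * f i j)
  pairSum-squares f = begin
    2 * (f 0F 1F * f 0F 2F + f 1F 0F * f 1F 2F + f 2F 0F * f 2F 1F)
      ≡⟨ solve 6 (λ a b c d e g → con 2 :* (a :* b :+ c :* d :+ e :* g)
                               := con 2 :* (a :* b) :+ con 2 :* (c :* d) :+ con 2 :* (e :* g))
               refl (f 0F 1F) (f 0F 2F) (f 1F 0F) (f 1F 2F) (f 2F 0F) (f 2F 1F) ⟩
    2 * (f 0F 1F * f 0F 2F) + 2 * (f 1F 0F * f 1F 2F) + 2 * (f 2F 0F * f 2F 1F)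
      ≤⟨ ℕₚ.+-mono-≤ (ℕₚ.+-mono-≤ (2*m*n≤m*m+n*n (f 0F 1F) (f 0F 2F)) (2*m*n≤m*m+n*n (f 1F 0F) (f 1F 2F)))
                     (2*m*n≤m*m+n*n (f 2F 0F) (f 2F 1F)) ⟩
    (sq 0F 1F + sq 0F 2F) + (sq 1F 0F + sq 1F 2F) + (sq 2F 0F + sq 2F 1F)
      ≡⟨ solve 6 (λ a b c d e g → (a :+ b) :+ (c :+ d) :+ (e :+ g) := a :+ (b :+ (c :+ (d :+ (e :+ (g :+ con 0))))))
               refl (sq 0F 1F) (sq 0F 2F) (sq 1F 0F) (sq 1F 2F) (sq 2F 0F) (sq 2F 1F) ⟩
    pairSum sq ∎
    where
    open ℕₚ.≤-Reasoning
    open +-*-Solver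
    sq : Fin 3 → Fin 3 → ℕ
    sq i j = f i j * f i j

  module _ {n : ℕ} (P : Palette n) where

    good-sym : ∀ i j a b → good P i j a b ≡ good P j i b a
    good-sym i j a b = cong or (map-cong (λ t → cong (isAdm P t ∧_) (∧-comm ⌊ coord i t ≟ a ⌋ ⌊ coord j t ≟ b ⌋))
                                         (allTriples n))

    admissible⇒good : ∀ i j t → T (isAdm P t) → T (good P i j (coord i t) (coord j t))
    admissible⇒good i j t adm = any⁺ _ (lose (∈-allTriples t)
      (from (T-∧ {isAdm P t} {diag i ∧ diag j}) (adm , from (T-∧ {diag i} {diag j}) (fromWitness refl , fromWitness refl))))
      where
      open Equivalence using (from)
      diag : Fin 3 → Bool
      diag k = ⌊ coord k t ≟ coord k t ⌋

    γ : Fin 3 → Fin 3 → Fin n → Fin n → ℕ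
    γ i j a b = χ (good P i j a b)

    γ₃ : Fin 3 → Fin 3 → Fin n → Fin n → Fin n → ℕ
    γ₃ i j a b c = γ i j (coord i (a , b , c)) (coord j (a , b , c))

    d : Fin 3 → Fin 3 → Fin n → ℕ
    d i j = dij P i j

    d≡∑γ : ∀ i j a → d i j a ≡ ∑[ b < n ] γ i j a b
    d≡∑γ i j a = count-tabulate (good P i j a) id

    ∑γ-transpose : ∀ i j b → ∑[ a < n ] γ i j a b ≡ d j i b
    ∑γ-transpose i j b = trans (sum-cong-≗ {n} λ a → cong χ (good-sym i j a b)) (sym (d≡∑γ j i b))

    S : Fin 3 → Fin 3 → ℕ
    S i j = ∑[ a < n ] d i j a

    S≡∑∑γ : ∀ i j → S i j ≡ ∑[ a < n ] ∑[ b < n ] γ i j a b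
    S≡∑∑γ i j = sum-cong-≗ {n} (d≡∑γ i j)

    S-sym : ∀ i j → S i j ≡ S j i
    S-sym i j = trans (S≡∑∑γ i j) (trans (∑-comm (γ i j)) (sum-cong-≗ {n} (∑γ-transpose i j)))

    χA : Fin n → Fin n → Fin n → ℕ
    χA a b c = χ (isAdm P (a , b , c))

    numAdm≡∑³ : numAdm P ≡ ∑³ χA
    numAdm≡∑³ =
      trans (count-concatMap-tabulate (isAdm P) (λ a → concatMap (λ b → map (λ c → a , b , c) (allFin n)) (allFin n)) id)
            (sum-cong-≗ {n} λ a →
      trans (count-concatMap-tabulate (isAdm P) (λ b → map (λ c → a , b , c) (allFin n)) id)
            (sum-cong-≗ {n} λ b →
      trans (cong (length ∘ filter (T? ∘ isAdm P)) (map-tabulate id (λ c → a , b , c)))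
            (count-tabulate (isAdm P) (λ c → a , b , c))))

    admissible-bound : ∀ a b c →
      (χA ⊕ (γ₃ 0F 1F ⊕ γ₃ 0F 2F ⊕ γ₃ 1F 2F)) a b c
        ≤ 1 + (γ₃ 0F 1F ⊛ γ₃ 0F 2F ⊕ γ₃ 0F 1F ⊛ γ₃ 1F 2F ⊕ γ₃ 0F 2F ⊛ γ₃ 1F 2F) a b c
    admissible-bound a b c =
      χ-bonferroni-forced (isAdm P t) (good P 0F 1F a b) (good P 0F 2F a c) (good P 1F 2F b c) λ adm →
        Equivalence.from T-∧ (admissible⇒good 0F 1F t adm ,
          Equivalence.from T-∧ (admissible⇒good 0F 2F t adm , admissible⇒good 1F 2F t adm))
      where
      t : Triple n
      t = (a , b , c)

    ∑³-γ₃ : n * (S 0F 1F + S 0F 2F + S 1F 2F) ≡ ∑³ (γ₃ 0F 1F) + ∑³ (γ₃ 0F 2F) + ∑³ (γ₃ 1F 2F)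
    ∑³-γ₃ = trans (ℕₚ.*-distribˡ-+ n (S 0F 1F + S 0F 2F) (S 1F 2F))
      (cong₂ _+_ (trans (ℕₚ.*-distribˡ-+ n (S 0F 1F) (S 0F 2F))
                        (cong₂ _+_ (trans (cong (n *_) (S≡∑∑γ 0F 1F)) (sym (∑³-const-c (γ 0F 1F))))
                                   (trans (cong (n *_) (S≡∑∑γ 0F 2F)) (sym (∑³-const-b (γ 0F 2F))))))
                 (trans (cong (n *_) (S≡∑∑γ 1F 2F)) (sym (∑³-const-a (γ 1F 2F)))))

    cherries : Fin n → ℕ
    cherries x = d 0F 1F x * d 0F 2F x + d 1F 0F x * d 1F 2F x + d 2F 0F x * d 2F 1F x

    ∑³-γ₃⊛γ₃ : ∑³ (γ₃ 0F 1F ⊛ γ₃ 0F 2F) + ∑³ (γ₃ 0F 1F ⊛ γ₃ 1F 2F) + ∑³ (γ₃ 0F 2F ⊛ γ₃ 1F 2F)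
             ≡ ∑[ x < n ] cherries x
    ∑³-γ₃⊛γ₃ = begin
      ∑³ (γ₃ 0F 1F ⊛ γ₃ 0F 2F) + ∑³ (γ₃ 0F 1F ⊛ γ₃ 1F 2F) + ∑³ (γ₃ 0F 2F ⊛ γ₃ 1F 2F)
        ≡⟨ cong₂ _+_ (cong₂ _+_ (∑³-ab*ac (γ 0F 1F) (γ 0F 2F)) (∑³-ab*bc (γ 0F 1F) (γ 1F 2F)))
                     (∑³-ac*bc (γ 0F 2F) (γ 1F 2F)) ⟩
      ∑[ a < n ] ((∑[ b < n ] γ 0F 1F a b) * (∑[ c < n ] γ 0F 2F a c))
        + ∑[ b < n ] ((∑[ a < n ] γ 0F 1F a b) * (∑[ c < n ] γ 1F 2F b c))
        + ∑[ c < n ] ((∑[ a < n ] γ 0F 2F a c) * (∑[ b < n ] γ 1F 2F b c))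
        ≡⟨ cong₂ _+_ (cong₂ _+_
             (sum-cong-≗ {n} λ x → sym (cong₂ _*_ (d≡∑γ 0F 1F x) (d≡∑γ 0F 2F x)))
             (sum-cong-≗ {n} λ x → cong₂ _*_ (∑γ-transpose 0F 1F x) (sym (d≡∑γ 1F 2F x))))
             (sum-cong-≗ {n} λ x → cong₂ _*_ (∑γ-transpose 0F 2F x) (∑γ-transpose 1F 2F x)) ⟩
      ∑[ x < n ] (d 0F 1F x * d 0F 2F x) + ∑[ x < n ] (d 1F 0F x * d 1F 2F x) + ∑[ x < n ] (d 2F 0F x * d 2F 1F x)
        ≡⟨ cong (_+ ∑[ x < n ] (d 2F 0F x * d 2F 1F x))
                (∑-distrib-+ (λ x → d 0F 1F x * d 0F 2F x) (λ x → d 1F 0F x * d 1F 2F x)) ⟨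
      ∑[ x < n ] (d 0F 1F x * d 0F 2F x + d 1F 0F x * d 1F 2F x) + ∑[ x < n ] (d 2F 0F x * d 2F 1F x)
        ≡⟨ ∑-distrib-+ (λ x → d 0F 1F x * d 0F 2F x + d 1F 0F x * d 1F 2F x) (λ x → d 2F 0F x * d 2F 1F x) ⟨
      ∑[ x < n ] cherries x ∎
      where open ≡-Reasoning

    triple-count-bound : numAdm P + n * (S 0F 1F + S 0F 2F + S 1F 2F) ≤ n ^ 3 + ∑[ x < n ] cherries x
    triple-count-bound = begin
      numAdm P + n * (S 0F 1F + S 0F 2F + S 1F 2F)
        ≡⟨ cong₂ _+_ numAdm≡∑³ ∑³-γ₃ ⟩
      ∑³ χA + (∑³ u + ∑³ v + ∑³ w)
        ≡⟨ ∑³-distrib-+₄ χA u v w ⟨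
      ∑³ (χA ⊕ (u ⊕ v ⊕ w))
        ≤⟨ ∑³-mono-≤ admissible-bound ⟩
      ∑³ (one ⊕ (u ⊛ v ⊕ u ⊛ w ⊕ v ⊛ w))
        ≡⟨ ∑³-distrib-+₄ one (u ⊛ v) (u ⊛ w) (v ⊛ w) ⟩
      ∑³ one + (∑³ (u ⊛ v) + ∑³ (u ⊛ w) + ∑³ (v ⊛ w))
        ≡⟨ cong₂ _+_ (∑³-one {n}) ∑³-γ₃⊛γ₃ ⟩
      n ^ 3 + ∑[ x < n ] cherries x ∎
      where
      open ℕₚ.≤-Reasoning
      one u v w : Fin n → Fin n → Fin n → ℕ
      one _ _ _ = 1
      u = γ₃ 0F 1F
      v = γ₃ 0F 2F
      w = γ₃ 1F 2F

    degreeSum degreeSquareSum : Fin n → ℕ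
    degreeSum x = pairSum (λ i j → d i j x)
    degreeSquareSum x = pairSum (λ i j → d i j x * d i j x)

    degree-bound : 2 * numAdm P + n * ∑[ x < n ] degreeSum x ≤ 2 * n ^ 3 + ∑[ x < n ] degreeSquareSum x
    degree-bound = begin
      2 * numAdm P + n * ∑[ x < n ] degreeSum x
        ≡⟨ cong (λ s → 2 * numAdm P + n * s) (trans (∑-sumₗ-comm (λ p x → uncurry (λ i j → d i j x) p) distinctPairs)
                                                    (pairSum-sym S S-sym)) ⟩
      2 * numAdm P + n * (2 * (S 0F 1F + S 0F 2F + S 1F 2F))
        ≡⟨ solve 3 (λ N n s → con 2 :* N :+ n :* (con 2 :* s) := con 2 :* (N :+ n :* s))
                 refl (numAdm P) n (S 0F 1F + S 0F 2F + S 1F 2F) ⟩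
      2 * (numAdm P + n * (S 0F 1F + S 0F 2F + S 1F 2F))
        ≤⟨ ℕₚ.*-monoʳ-≤ 2 triple-count-bound ⟩
      2 * (n ^ 3 + ∑[ x < n ] cherries x)
        ≡⟨ trans (ℕₚ.*-distribˡ-+ 2 (n ^ 3) _) (cong (2 * n ^ 3 +_) (*-distribˡ-sum 2 cherries)) ⟩
      2 * n ^ 3 + ∑[ x < n ] (2 * cherries x)
        ≤⟨ ℕₚ.+-monoʳ-≤ (2 * n ^ 3) (∑-mono-≤ λ x → pairSum-squares (λ i j → d i j x)) ⟩
      2 * n ^ 3 + ∑[ x < n ] degreeSquareSum x ∎
      where
      open ℕₚ.≤-Reasoning
      open +-*-Solver

module RationalCasts where

  import Data.Nat as ℕ
  open import Data.Nat using (suc)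
  import Data.Nat.Properties as ℕₚ
  open import Data.Integer as ℤ using (+_)
  import Data.Integer.Properties as ℤₚ
  open import Data.Rational using (ℚ; _/_; _+_; _*_; _≤_; 1ℚ; toℚᵘ)
  import Data.Rational.Properties as ℚₚ
  open import Data.Rational.Unnormalised as ℚᵘ using (mkℚᵘ; *≡*; *≤*)
  import Data.Rational.Unnormalised.Properties as ℚᵘₚ
  open import Relation.Binary.PropositionalEquality

  toℚᵘ-/ : ∀ i m → toℚᵘ (i / suc m) ℚᵘ.≃ mkℚᵘ i m
  toℚᵘ-/ i m = ℚₚ.toℚᵘ-fromℚᵘ (mkℚᵘ i m)

  /-+-/ : ∀ i j m k → i / suc m + j / suc k ≡ (i ℤ.* + suc k ℤ.+ j ℤ.* + suc m) / (suc m ℕ.* suc k)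
  /-+-/ i j m k = ℚₚ.toℚᵘ-injective (begin
    toℚᵘ (i / suc m + j / suc k)            ≈⟨ ℚₚ.toℚᵘ-homo-+ (i / suc m) (j / suc k) ⟩
    toℚᵘ (i / suc m) ℚᵘ.+ toℚᵘ (j / suc k)  ≈⟨ ℚᵘₚ.+-cong (toℚᵘ-/ i m) (toℚᵘ-/ j k) ⟩
    mkℚᵘ i m ℚᵘ.+ mkℚᵘ j k                  ≈⟨ toℚᵘ-/ _ _ ⟨
    toℚᵘ ((i ℤ.* + suc k ℤ.+ j ℤ.* + suc m) / (suc m ℕ.* suc k)) ∎)
    where open ℚᵘₚ.≃-Reasoning

  /-*-/ : ∀ i j m k → (i / suc m) * (j / suc k) ≡ (i ℤ.* j) / (suc m ℕ.* suc k)
  /-*-/ i j m k = ℚₚ.toℚᵘ-injective (begin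
    toℚᵘ ((i / suc m) * (j / suc k))        ≈⟨ ℚₚ.toℚᵘ-homo-* (i / suc m) (j / suc k) ⟩
    toℚᵘ (i / suc m) ℚᵘ.* toℚᵘ (j / suc k)  ≈⟨ ℚᵘₚ.*-cong (toℚᵘ-/ i m) (toℚᵘ-/ j k) ⟩
    mkℚᵘ i m ℚᵘ.* mkℚᵘ j k                  ≈⟨ toℚᵘ-/ _ _ ⟨
    toℚᵘ ((i ℤ.* j) / (suc m ℕ.* suc k))    ∎)
    where open ℚᵘₚ.≃-Reasoning

  fromℕ : ℕ → ℚ
  fromℕ k = + k / 1

  fromℕ-+ : ∀ a b → fromℕ (a ℕ.+ b) ≡ fromℕ a + fromℕ b
  fromℕ-+ a b = sym (trans (/-+-/ (+ a) (+ b) 0 0)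
    (cong (_/ 1) (trans (cong₂ ℤ._+_ (ℤₚ.*-identityʳ (+ a)) (ℤₚ.*-identityʳ (+ b))) (sym (ℤₚ.pos-+ a b)))))

  fromℕ-* : ∀ a b → fromℕ (a ℕ.* b) ≡ fromℕ a * fromℕ b
  fromℕ-* a b = sym (trans (/-*-/ (+ a) (+ b) 0 0) (cong (_/ 1) (sym (ℤₚ.pos-* a b))))

  fromℕ-mono-≤ : ∀ {a b} → a ℕ.≤ b → fromℕ a ≤ fromℕ b
  fromℕ-mono-≤ {a} {b} a≤b = ℚₚ.toℚᵘ-cancel-≤
    (ℚᵘₚ.≤-respˡ-≃ (ℚᵘₚ.≃-sym (toℚᵘ-/ (+ a) 0)) (ℚᵘₚ.≤-respʳ-≃ (ℚᵘₚ.≃-sym (toℚᵘ-/ (+ b) 0))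
      (*≤* (ℤₚ.*-monoʳ-≤-nonNeg (+ 1) (ℤ.+≤+ a≤b)))))

  /-as-fromℕ : ∀ a m → + a / suc m ≡ fromℕ a * (+ 1 / suc m)
  /-as-fromℕ a m = sym (trans (/-*-/ (+ a) (+ 1) 0 m) (ℚₚ./-cong (ℤₚ.*-identityʳ (+ a)) (ℕₚ.+-identityʳ (suc m))))

  n/n≡1 : ∀ m → + suc m / suc m ≡ 1ℚ
  n/n≡1 m = ℚₚ.toℚᵘ-injective (ℚᵘₚ.≃-trans (toℚᵘ-/ (+ suc m) m) (*≡* (ℤₚ.*-comm (+ suc m) (+ 1))))

  1/n*n≡1 : ∀ m → (+ 1 / suc m) * fromℕ (suc m) ≡ 1ℚ
  1/n*n≡1 m = trans (/-*-/ (+ 1) (+ suc m) m 0)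
    (trans (ℚₚ./-cong (ℤₚ.*-identityˡ (+ suc m)) (ℕₚ.*-identityʳ (suc m))) (n/n≡1 m))

module DensityBound where

  import Data.Nat as ℕ
  open import Data.Nat using (suc)
  import Data.Nat.Properties as ℕₚ
  open import Data.Nat.ListAction using () renaming (sum to sumₗ)
  open import Algebra.Properties.Semiring.Sum ℕₚ.+-*-semiring using (sum-syntax)
  open import Data.Integer using (+_)
  open import Data.Rational using (ℚ; _/_; _+_; _*_; _-_; -_; _≤_; ½; 1ℚ; 0ℚ; NonNegative)
  import Data.Rational.Properties as ℚₚ
  open import Data.Rational.Solver using (module +-*-Solver)
  open import Data.List using (List; []; _∷_; length; map; allFin)
  open import Data.List.Properties using (length-tabulate)
  open import Data.Product using (_×_; _,_; proj₁; proj₂)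
  open import Data.Fin using (Fin)
  open import Function using (id)
  open import Relation.Binary.PropositionalEquality
  open Counting using (sumₗ-map-tabulate; degreeSum; degreeSquareSum; degree-bound)
  open RationalCasts

  sumℚ-cong : ∀ {A : Set} {f g : A → ℚ} (xs : List A) → (∀ x → f x ≡ g x) → sumℚ f xs ≡ sumℚ g xs
  sumℚ-cong []       f≡g = refl
  sumℚ-cong (x ∷ xs) f≡g = cong₂ _+_ (f≡g x) (sumℚ-cong xs f≡g)

  sumℚ-affine : ∀ {A : Set} (α β γ : ℚ) (f g : A → ℕ) (xs : List A) →
    sumℚ (λ x → α * fromℕ (f x) + β * fromℕ (g x) + γ) xs
      ≡ α * fromℕ (sumₗ (map f xs)) + β * fromℕ (sumₗ (map g xs)) + γ * fromℕ (length xs)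
  sumℚ-affine α β γ f g [] =
    solve 3 (λ α β γ → con 0ℚ := α :* con 0ℚ :+ β :* con 0ℚ :+ γ :* con 0ℚ) refl α β γ
    where open +-*-Solver
  sumℚ-affine α β γ f g (x ∷ xs)
    rewrite sumℚ-affine α β γ f g xs
          | fromℕ-+ (f x) (sumₗ (map f xs)) | fromℕ-+ (g x) (sumₗ (map g xs)) | fromℕ-+ 1 (length xs) =
    solve 8 (λ α β γ fx gx Σf Σg l → α :* fx :+ β :* gx :+ γ :+ (α :* Σf :+ β :* Σg :+ γ :* l)
                                 := α :* (fx :+ Σf) :+ β :* (gx :+ Σg) :+ γ :* (con 1ℚ :+ l))
            refl α β γ (fromℕ (f x)) (fromℕ (g x)) (fromℕ (sumₗ (map f xs))) (fromℕ (sumₗ (map g xs))) (fromℕ (length xs))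
    where open +-*-Solver

  ¼ : ℚ
  ¼ = + 1 / 4

  -- Both sides are polynomials in ι and ν that agree only modulo ι ν = 1; F and G are
  -- their normal forms with ι ν abstracted to w.
  cleared-identity : ∀ ι ν Q D → ι * ν ≡ 1ℚ →
    ½ * (ι * (ι * ι)) * (fromℕ 2 * (ν * (ν * (ν * 1ℚ))) + Q) - ½ * (ι * (ι * ι)) * (ν * D)
      ≡ ¼ + (½ * ι) * ((ι * ι) * Q + (- ι) * D + (¼ * fromℕ 6) * ν)
  cleared-identity ι ν Q D ιν≡1 = begin
    ½ * (ι * (ι * ι)) * (fromℕ 2 * (ν * (ν * (ν * 1ℚ))) + Q) - ½ * (ι * (ι * ι)) * (ν * D)
      ≡⟨ solve 4 (λ ι ν Q D → con ½ :* (ι :* (ι :* ι)) :* (con (fromℕ 2) :* (ν :* (ν :* (ν :* con 1ℚ))) :+ Q)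
                              :- con ½ :* (ι :* (ι :* ι)) :* (ν :* D)
                           := F-expr (ι :* ν) ι Q D)
               refl ι ν Q D ⟩
    F (ι * ν)  ≡⟨ cong F ιν≡1 ⟩
    F 1ℚ       ≡⟨ solve 3 (λ ι Q D → F-expr (con 1ℚ) ι Q D := G-expr (con 1ℚ) ι Q D) refl ι Q D ⟩
    G 1ℚ       ≡⟨ cong G ιν≡1 ⟨
    G (ι * ν)
      ≡⟨ solve 4 (λ ι ν Q D → G-expr (ι :* ν) ι Q D
                           := con ¼ :+ (con ½ :* ι) :* ((ι :* ι) :* Q :+ (:- ι) :* D :+ (con ¼ :* con (fromℕ 6)) :* ν))
               refl ι ν Q D ⟩
    ¼ + (½ * ι) * ((ι * ι) * Q + (- ι) * D + (¼ * fromℕ 6) * ν) ∎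
    where
    open ≡-Reasoning
    open +-*-Solver
    F-expr G-expr : ∀ {m} → Polynomial m → Polynomial m → Polynomial m → Polynomial m → Polynomial m
    F-expr w ι Q D = w :* w :* w :+ con ½ :* (ι :* (ι :* ι)) :* Q :- con ½ :* (ι :* ι) :* D :* w
    G-expr w ι Q D = con ¼ :+ (con ½ :* con (¼ * fromℕ 6)) :* w :+ con ½ :* (ι :* (ι :* ι)) :* Q :- con ½ :* (ι :* ι) :* D
    F G : ℚ → ℚ
    F w = w * w * w + ½ * (ι * (ι * ι)) * Q - ½ * (ι * ι) * D * w
    G w = ¼ + (½ * (¼ * fromℕ 6)) * w + ½ * (ι * (ι * ι)) * Q - ½ * (ι * ι) * D

  cleared-bound⇒density-bound : ∀ (ι : ℚ) .{{_ : NonNegative ι}} (n N D Q : ℕ) → ι * fromℕ n ≡ 1ℚ →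
    2 ℕ.* N ℕ.+ n ℕ.* D ℕ.≤ 2 ℕ.* n ℕ.^ 3 ℕ.+ Q →
    fromℕ N * (ι * (ι * ι)) ≤ ¼ + (½ * ι) * ((ι * ι) * fromℕ Q + (- ι) * fromℕ D + (¼ * fromℕ 6) * fromℕ n)
  cleared-bound⇒density-bound ι n N D Q ιν≡1 cleared = begin
    fromℕ N * (ι * (ι * ι))
      ≡⟨ solve 4 (λ ι ν N D → N :* (ι :* (ι :* ι))
                           := con ½ :* (ι :* (ι :* ι)) :* (con (fromℕ 2) :* N :+ ν :* D) :- con ½ :* (ι :* (ι :* ι)) :* (ν :* D))
               refl ι ν (fromℕ N) (fromℕ D) ⟩
    k * (fromℕ 2 * fromℕ N + ν * fromℕ D) - k * (ν * fromℕ D)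
      ≤⟨ ℚₚ.+-monoˡ-≤ (- (k * (ν * fromℕ D))) (ℚₚ.*-monoˡ-≤-nonNeg k cast) ⟩
    k * (fromℕ 2 * (ν * (ν * (ν * 1ℚ))) + fromℕ Q) - k * (ν * fromℕ D)
      ≡⟨ cleared-identity ι ν (fromℕ Q) (fromℕ D) ιν≡1 ⟩
    ¼ + (½ * ι) * ((ι * ι) * fromℕ Q + (- ι) * fromℕ D + (¼ * fromℕ 6) * ν) ∎
    where
    open ℚₚ.≤-Reasoning
    open +-*-Solver
    ν k : ℚ
    ν = fromℕ n
    k = ½ * (ι * (ι * ι))
    instance
      k-nonNeg : NonNegative k
      k-nonNeg = ℚₚ.nonNeg*nonNeg⇒nonNeg ½ (ι * (ι * ι))
        {{ℚₚ.nonNeg*nonNeg⇒nonNeg ι (ι * ι) {{ℚₚ.nonNeg*nonNeg⇒nonNeg ι ι}}}}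
    cast : fromℕ 2 * fromℕ N + ν * fromℕ D ≤ fromℕ 2 * (ν * (ν * (ν * 1ℚ))) + fromℕ Q
    cast = subst₂ _≤_
      (trans (fromℕ-+ (2 ℕ.* N) (n ℕ.* D)) (cong₂ _+_ (fromℕ-* 2 N) (fromℕ-* n D)))
      (trans (fromℕ-+ (2 ℕ.* n ℕ.^ 3) Q) (cong (_+ fromℕ Q) (trans (fromℕ-* 2 (n ℕ.^ 3))
        (cong (fromℕ 2 *_) (trans (fromℕ-* n _) (cong (ν *_) (trans (fromℕ-* n _) (cong (ν *_) (fromℕ-* n 1)))))))))
      (fromℕ-mono-≤ cleared)

  module _ (m : ℕ) (P : Palette (suc m)) where

    ι : ℚ
    ι = + 1 / suc m

    instance
      ι-nonNeg : NonNegative ι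
      ι-nonNeg = ℚₚ.normalize-nonNeg 1 (suc m)

    density≡ : density P ≡ fromℕ (numAdm P) * (ι * (ι * ι))
    density≡ = trans (/-as-fromℕ (numAdm P) _) (cong (fromℕ (numAdm P) *_) (sym (begin
      ι * (ι * ι)                          ≡⟨ cong (ι *_) (/-*-/ (+ 1) (+ 1) m m) ⟩
      ι * (+ 1 / (suc m ℕ.* suc m))        ≡⟨ /-*-/ (+ 1) (+ 1) m (m ℕ.+ m ℕ.* suc m) ⟩
      + 1 / (suc m ℕ.* (suc m ℕ.* suc m))  ≡⟨ ℚₚ./-cong {p₁ = + 1} refl (cong (λ k → suc m ℕ.* (suc m ℕ.* k))
                                                                          (sym (ℕₚ.*-identityʳ (suc m)))) ⟩
      + 1 / (suc m ℕ.^ 3)                  ∎)))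
      where open ≡-Reasoning

    square-expansion : ∀ k → (+ k / suc m - ½) * (+ k / suc m - ½) ≡ (ι * ι) * fromℕ (k ℕ.* k) + (- ι) * fromℕ k + ¼
    square-expansion k = begin
      (+ k / suc m - ½) * (+ k / suc m - ½)
        ≡⟨ cong (λ x → (x - ½) * (x - ½)) (/-as-fromℕ k m) ⟩
      (fromℕ k * ι - ½) * (fromℕ k * ι - ½)
        ≡⟨ solve 2 (λ x ι → (x :* ι :- con ½) :* (x :* ι :- con ½) := (ι :* ι) :* (x :* x) :+ (:- ι) :* x :+ con ¼)
                 refl (fromℕ k) ι ⟩
      (ι * ι) * (fromℕ k * fromℕ k) + (- ι) * fromℕ k + ¼
        ≡⟨ cong (λ y → (ι * ι) * y + (- ι) * fromℕ k + ¼) (fromℕ-* k k) ⟨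
      (ι * ι) * fromℕ (k ℕ.* k) + (- ι) * fromℕ k + ¼ ∎
      where
      open ≡-Reasoning
      open +-*-Solver

    pairs-expansion : ∀ a →
      sumℚ (λ p → (eij P (proj₁ p) (proj₂ p) a - ½) * (eij P (proj₁ p) (proj₂ p) a - ½)) distinctPairs
        ≡ (ι * ι) * fromℕ (degreeSquareSum P a) + (- ι) * fromℕ (degreeSum P a) + ¼ * fromℕ 6
    pairs-expansion a = trans (sumℚ-cong distinctPairs λ p → square-expansion (dij P (proj₁ p) (proj₂ p) a))
                              (sumℚ-affine (ι * ι) (- ι) ¼ (λ p → d p ℕ.* d p) d distinctPairs)
      where
      d : Fin 3 × Fin 3 → ℕ
      d (i , j) = dij P i j a

    bound≡ : bound P ≡ ¼ + (½ * ι) * ((ι * ι) * fromℕ (∑[ a < suc m ] degreeSquareSum P a)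
                                      + (- ι) * fromℕ (∑[ a < suc m ] degreeSum P a) + (¼ * fromℕ 6) * fromℕ (suc m))
    bound≡ = cong₂ (λ h s → ¼ + h * s) (sym (/-*-/ (+ 1) (+ 1) 1 m)) (begin
      sumℚ (λ a → sumℚ (λ p → (eij P (proj₁ p) (proj₂ p) a - ½) * (eij P (proj₁ p) (proj₂ p) a - ½)) distinctPairs) colours
        ≡⟨ sumℚ-cong colours pairs-expansion ⟩
      sumℚ (λ a → (ι * ι) * fromℕ (degreeSquareSum P a) + (- ι) * fromℕ (degreeSum P a) + ¼ * fromℕ 6) colours
        ≡⟨ sumℚ-affine (ι * ι) (- ι) (¼ * fromℕ 6) (degreeSquareSum P) (degreeSum P) colours ⟩
      (ι * ι) * fromℕ (sumₗ (map (degreeSquareSum P) colours)) + (- ι) * fromℕ (sumₗ (map (degreeSum P) colours))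
        + (¼ * fromℕ 6) * fromℕ (length colours)
        ≡⟨ cong₂ (λ q s → (ι * ι) * fromℕ q + (- ι) * fromℕ s + (¼ * fromℕ 6) * fromℕ (length colours))
                 (sumₗ-map-tabulate (degreeSquareSum P) id) (sumₗ-map-tabulate (degreeSum P) id) ⟩
      (ι * ι) * fromℕ (∑[ a < suc m ] degreeSquareSum P a) + (- ι) * fromℕ (∑[ a < suc m ] degreeSum P a)
        + (¼ * fromℕ 6) * fromℕ (length colours)
        ≡⟨ cong (λ l → (ι * ι) * fromℕ (∑[ a < suc m ] degreeSquareSum P a) + (- ι) * fromℕ (∑[ a < suc m ] degreeSum P a)
                        + (¼ * fromℕ 6) * fromℕ l) (length-tabulate {n = suc m} id) ⟩
      (ι * ι) * fromℕ (∑[ a < suc m ] degreeSquareSum P a) + (- ι) * fromℕ (∑[ a < suc m ] degreeSum P a)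
        + (¼ * fromℕ 6) * fromℕ (suc m) ∎)
      where
      open ≡-Reasoning
      colours : List (Fin (suc m))
      colours = allFin (suc m)

    density≤bound : density P ≤ bound P
    density≤bound = subst₂ _≤_ (sym density≡) (sym bound≡)
      (cleared-bound⇒density-bound ι (suc m) (numAdm P) _ _ (1/n*n≡1 m) (degree-bound P))

open import Data.Nat using (suc)
open import Data.Rational using (_≤_)

lemma2p2 : (n : ℕ) .{{_ : NonZero n}} (P : Palette n) → density P ≤ bound P
lemma2p2 (suc m) P = DensityBound.density≤bound m P
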